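{- Let $G$ be a finite simple graph, $c:V(G)\to\mathbb{R}_{\geqslant 0}$, and let $u,u'\in V(G)$ be true twins. Let $G':=G-u'$ and define $c':V(G')\to\mathbb{R}_{\geqslant 0}$ by $c'(v):=c(v)$ for $v\in V(G')\setminus\{u\}$ and $c'(u):=c(u)+c(u')$. Then $\mathrm{OPT}(G,c)=\mathrm{OPT}(G',c')$.
   Context: Two vertices $u,u'$ of a graph $G$ are true twins if they are adjacent and have the same neighborhood in $G-\{u,u'\}$. A set $X\subseteq V(G)$ is a hitting set of $G$ if $G-X$ contains no induced subgraph isomorphic to $P_3$ (the path on three vertices). For $c:V(G)\to\mathbb{R}_{\geqslant 0}$, $c(X)=\sum_{v\in X}c(v)$ and $\mathrm{OPT}(G,c)$ is the minimum of $c(X)$ over all hitting sets $X$ of $G$. -}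

module Defs where

open import Level using (Level; _⊔_) renaming (suc to lsuc)
open import Data.Bool using (Bool; true; false; if_then_else_)
open import Data.Nat using (ℕ; zero) renaming (suc to sucℕ)
open import Data.Fin using (Fin; suc; punchIn; _≟_)
open import Data.Sum using (_⊎_)
open import Data.Product using (Σ; ∃; _×_; _,_)
open import Relation.Nullary using (¬_; yes; no)
open import Relation.Binary.PropositionalEquality using (_≡_; _≢_)

-- The paper uses c : V(G) → ℝ≥0.  Agda's standard
-- library has no real numbers, so we abstract over any structure
-- satisfying the (order / additive) properties of (ℝ≥0, +, 0, ≤) that
-- are relevant; ℝ≥0 is an instance.

record Weights (a ℓ : Level) : Set (lsuc (a ⊔ ℓ)) where
  infixl 6 _+_
  infix 4 _≤_
  field
    Carrier   : Set a
    _+_       : Carrier → Carrier → Carrier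
    0#        : Carrier
    _≤_       : Carrier → Carrier → Set ℓ
    +-assoc   : ∀ x y z → (x + y) + z ≡ x + (y + z)
    +-comm    : ∀ x y → x + y ≡ y + x
    +-identityˡ : ∀ x → 0# + x ≡ x
    ≤-refl    : ∀ {x} → x ≤ x
    ≤-trans   : ∀ {x y z} → x ≤ y → y ≤ z → x ≤ z
    ≤-antisym : ∀ {x y} → x ≤ y → y ≤ x → x ≡ y
    ≤-total   : ∀ x y → (x ≤ y) ⊎ (y ≤ x)
    +-mono-≤  : ∀ {x y z w} → x ≤ y → z ≤ w → x + z ≤ y + w
    0≤        : ∀ x → 0# ≤ x

record Graph (n : ℕ) : Set where
  field
    adj     : Fin n → Fin n → Bool
    sym     : ∀ i j → adj i j ≡ adj j i
    irrefl  : ∀ i → adj i i ≡ false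

open Graph public

Adj : ∀ {n} → Graph n → Fin n → Fin n → Set
Adj G i j = adj G i j ≡ true

VSet : ℕ → Set
VSet n = Fin n → Bool

_∈ᵥ_ : ∀ {n} → Fin n → VSet n → Set
v ∈ᵥ X = X v ≡ true

_∉ᵥ_ : ∀ {n} → Fin n → VSet n → Set
v ∉ᵥ X = X v ≡ false

-- G - X contains an induced P₃: vertices a - b - c outside X with
-- a ~ b, b ~ c, a ≁ c and a ≠ c (a ≠ b, b ≠ c follow from looplessness).
HasInducedP3Outside : ∀ {n} → Graph n → VSet n → Set
HasInducedP3Outside G X =
  Σ _ λ a → Σ _ λ b → Σ _ λ c →
    a ∉ᵥ X × b ∉ᵥ X × c ∉ᵥ X × a ≢ c ×
    Adj G a b × Adj G b c × ¬ Adj G a c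

IsHittingSet : ∀ {n} → Graph n → VSet n → Set
IsHittingSet G X = ¬ HasInducedP3Outside G X

module _ {a ℓ} (W : Weights a ℓ) where
  open Weights W

  sumFin : ∀ {n} → (Fin n → Carrier) → Carrier
  sumFin {zero}   f = 0#
  sumFin {sucℕ n} f = f Fin.zero + sumFin (λ i → f (suc i))

  cost : ∀ {n} → (Fin n → Carrier) → VSet n → Carrier
  cost c X = sumFin (λ v → if X v then c v else 0#)

  IsOPT : ∀ {n} → Graph n → (Fin n → Carrier) → Carrier → Set (a ⊔ ℓ)
  IsOPT G c m =
    (Σ (VSet _) λ X → IsHittingSet G X × cost c X ≡ m) ×
    (∀ X → IsHittingSet G X → m ≤ cost c X)

TrueTwins : ∀ {n} → Graph n → Fin n → Fin n → Set
TrueTwins G u u' =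
  Adj G u u' × (∀ w → w ≢ u → w ≢ u' → adj G u w ≡ adj G u' w)

deleteVertex : ∀ {n} → Graph (sucℕ n) → Fin (sucℕ n) → Graph n
deleteVertex G u' = record
  { adj    = λ i j → adj G (punchIn u' i) (punchIn u' j)
  ; sym    = λ i j → sym G (punchIn u' i) (punchIn u' j)
  ; irrefl = λ i → irrefl G (punchIn u' i)
  }

mergedCost : ∀ {a ℓ} (W : Weights a ℓ) {n} →
  (Fin (sucℕ n) → Weights.Carrier W) → Fin (sucℕ n) → Fin n →
  Fin n → Weights.Carrier W
mergedCost W c u' w i with i ≟ w
... | yes _ = Weights._+_ W (c (punchIn u' w)) (c u')
... | no  _ = c (punchIn u' i)

-- Write u = punchIn u' w and G' = G - u'.  A set X ⊆ V(G) restricts to G' by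
-- keeping u exactly when both twins lie in X; when u ∈ X this is X read through
-- the transposition of u and u', which is an automorphism of G, so the
-- restriction is a preimage of X under an induced embedding G' → G and stays a
-- hitting set, at cost c'(X') ≤ c(X).  Conversely Y ⊆ V(G') extends to G by
-- giving u' the membership of u, at cost exactly c'(Y).  The extension is
-- invariant under the transposition, and an induced P₃ never contains two true
-- twins, so every induced P₃ of G outside it can be moved off u' into G'.
-- Cost-nonincreasing maps between hitting sets in both directions force the
-- two optima to agree.
module Submission where

open import Defs hiding (sym)
open import Level using (_⊔_)
open import Data.Bool using (true; false; if_then_else_; _∧_)
open import Data.Nat using (ℕ; zero; suc)
open import Data.Fin using (Fin; zero; suc; punchIn; punchOut; _≟_)
open import Data.Fin.Properties
  using (punchIn-injective; punchInᵢ≢i; punchIn-punchOut; punchOut-cong; punchOut-punchIn)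
open import Data.Fin.Permutation.Components using (transpose; transpose-inverse)
open import Data.Product using (∃; _×_; _,_; proj₁; proj₂)
open import Data.Sum using (_⊎_; inj₁; inj₂)
open import Data.Empty using (⊥; ⊥-elim)
open import Function using (_∘_; id; _⇔_; mk⇔)
open import Function.Definitions using (Injective)
open import Relation.Nullary using (¬_; yes; no)
open import Relation.Binary.PropositionalEquality

module _ {a ℓ} (W : Weights a ℓ) where
  open Weights W

  ≤-reflexive : ∀ {x y} → x ≡ y → x ≤ y
  ≤-reflexive refl = ≤-refl

  +-leftComm : ∀ x y z → x + (y + z) ≡ y + (x + z)
  +-leftComm x y z = begin
    x + (y + z)  ≡⟨ sym (+-assoc x y z) ⟩
    (x + y) + z  ≡⟨ cong (_+ z) (+-comm x y) ⟩
    (y + x) + z  ≡⟨ +-assoc y x z ⟩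
    y + (x + z)  ∎
    where open ≡-Reasoning

  if-+-distrib : ∀ p x y → (if p then x + y else 0#) ≡ (if p then x else 0#) + (if p then y else 0#)
  if-+-distrib true  x y = refl
  if-+-distrib false x y = sym (+-identityˡ 0#)

  if-∧-≤ : ∀ p q x y → (if p ∧ q then x + y else 0#) ≤ (if p then x else 0#) + (if q then y else 0#)
  if-∧-≤ true  true  x y = ≤-refl
  if-∧-≤ true  false x y = 0≤ _
  if-∧-≤ false q     x y = 0≤ _

  sumFin-cong : ∀ {n} {f g : Fin n → Carrier} → (∀ i → f i ≡ g i) → sumFin W f ≡ sumFin W g
  sumFin-cong {zero}  f≗g = refl
  sumFin-cong {suc n} f≗g = cong₂ _+_ (f≗g zero) (sumFin-cong (f≗g ∘ suc))

  sumFin-mono-≤ : ∀ {n} {f g : Fin n → Carrier} → (∀ i → f i ≤ g i) → sumFin W f ≤ sumFin W g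
  sumFin-mono-≤ {zero}  f≤g = ≤-refl
  sumFin-mono-≤ {suc n} f≤g = +-mono-≤ (f≤g zero) (sumFin-mono-≤ (f≤g ∘ suc))

  sumFin-punchIn : ∀ {n} (f : Fin (suc n) → Carrier) p →
                   sumFin W f ≡ f p + sumFin W (f ∘ punchIn p)
  sumFin-punchIn f zero = refl
  sumFin-punchIn {suc n} f (suc p) = begin
    f zero + sumFin W (f ∘ suc)
      ≡⟨ cong (f zero +_) (sumFin-punchIn (f ∘ suc) p) ⟩
    f zero + (f (suc p) + sumFin W (f ∘ suc ∘ punchIn p))
      ≡⟨ +-leftComm (f zero) (f (suc p)) _ ⟩
    f (suc p) + (f zero + sumFin W (f ∘ suc ∘ punchIn p))
      ∎
    where open ≡-Reasoning

  mergedCost-merged : ∀ {n} (f : Fin (suc n) → Carrier) u' w →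
                      mergedCost W f u' w w ≡ f (punchIn u' w) + f u'
  mergedCost-merged f u' w with w ≟ w
  ... | yes _   = refl
  ... | no w≢w = ⊥-elim (w≢w refl)

  mergedCost-other : ∀ {n} (f : Fin (suc n) → Carrier) u' {w i} → i ≢ w →
                     mergedCost W f u' w i ≡ f (punchIn u' i)
  mergedCost-other f u' {w} {i} i≢w with i ≟ w
  ... | yes i≡w = ⊥-elim (i≢w i≡w)
  ... | no _    = refl

  sumFin-mergedCost : ∀ {n} (f : Fin (suc n) → Carrier) u' (w : Fin n) →
                      sumFin W f ≡ sumFin W (mergedCost W f u' w)
  sumFin-mergedCost {zero}  f u' ()
  sumFin-mergedCost {suc n} f u' w = begin
    sumFin W f
      ≡⟨ sumFin-punchIn f u' ⟩
    f u' + sumFin W (f ∘ punchIn u')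
      ≡⟨ cong (f u' +_) (sumFin-punchIn (f ∘ punchIn u') w) ⟩
    f u' + (f (punchIn u' w) + rest)
      ≡⟨ +-leftComm (f u') _ rest ⟩
    f (punchIn u' w) + (f u' + rest)
      ≡⟨ sym (+-assoc _ (f u') rest) ⟩
    (f (punchIn u' w) + f u') + rest
      ≡⟨ cong₂ _+_ (sym (mergedCost-merged f u' w))
                   (sumFin-cong λ j → sym (mergedCost-other f u' (punchInᵢ≢i w j))) ⟩
    merged w + sumFin W (merged ∘ punchIn w)
      ≡⟨ sym (sumFin-punchIn merged w) ⟩
    sumFin W merged
      ∎
    where
    open ≡-Reasoning
    rest = sumFin W (f ∘ punchIn u' ∘ punchIn w)
    merged = mergedCost W f u' w

  record HittingSetReduction {m n} (G : Graph m) (c : Fin m → Carrier)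
                             (H : Graph n) (d : Fin n → Carrier) : Set (a ⊔ ℓ) where
    field
      reduce         : VSet m → VSet n
      reduce-hitting : ∀ {X} → IsHittingSet G X → IsHittingSet H (reduce X)
      reduce-cost    : ∀ X → cost W d (reduce X) ≤ cost W c X

  module _ {m n} {G : Graph m} {c : Fin m → Carrier} {H : Graph n} {d : Fin n → Carrier} where

    IsOPT-transport : HittingSetReduction G c H d → HittingSetReduction H d G c →
                      ∀ {opt} → IsOPT W G c opt → IsOPT W H d opt
    IsOPT-transport r s {opt} ((X , X-hitting , cX≡opt) , opt-minimal) =
      (reduce r X , reduce-hitting r X-hitting , ≤-antisym upper (opt≤ (reduce-hitting r X-hitting))) ,
      λ _ → opt≤
      where
      open HittingSetReduction
      opt≤ : ∀ {Y} → IsHittingSet H Y → opt ≤ cost W d Y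
      opt≤ {Y} Y-hitting = ≤-trans (opt-minimal _ (reduce-hitting s Y-hitting)) (reduce-cost s Y)
      upper : cost W d (reduce r X) ≤ opt
      upper = subst (cost W d (reduce r X) ≤_) cX≡opt (reduce-cost r X)

  IsOPT-⇔ : ∀ {m n} {G : Graph m} {c} {H : Graph n} {d} →
            HittingSetReduction G c H d → HittingSetReduction H d G c →
            ∀ opt → IsOPT W G c opt ⇔ IsOPT W H d opt
  IsOPT-⇔ r s opt = mk⇔ (IsOPT-transport r s) (IsOPT-transport s r)

P3 : ∀ {n} → Graph n → Fin n → Fin n → Fin n → Set
P3 G a b c = a ≢ c × Adj G a b × Adj G b c × ¬ Adj G a c

-- Laid out so that HasInducedP3Outside G X is Σ a b c P3Outside G X a b c on the nose.
P3Outside : ∀ {n} → Graph n → VSet n → Fin n → Fin n → Fin n → Set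
P3Outside G X a b c = a ∉ᵥ X × b ∉ᵥ X × c ∉ᵥ X × P3 G a b c

Avoids : ∀ {n} → Fin n → Fin n → Fin n → Fin n → Set
Avoids v a b c = a ≢ v × b ≢ v × c ≢ v

Meets : ∀ {n} → Fin n → Fin n → Fin n → Fin n → Set
Meets v a b c = a ≡ v ⊎ b ≡ v ⊎ c ≡ v

meets-or-avoids : ∀ {n} (v a b c : Fin n) → Meets v a b c ⊎ Avoids v a b c
meets-or-avoids v a b c with a ≟ v | b ≟ v | c ≟ v
... | yes a≡v | _       | _       = inj₁ (inj₁ a≡v)
... | no _    | yes b≡v | _       = inj₁ (inj₂ (inj₁ b≡v))
... | no _    | no _    | yes c≡v = inj₁ (inj₂ (inj₂ c≡v))
... | no a≢v  | no b≢v  | no c≢v  = inj₂ (a≢v , b≢v , c≢v)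

IsHittingSet-resp : ∀ {n} {G : Graph n} {X Y} → (∀ v → X v ≡ Y v) → IsHittingSet G X → IsHittingSet G Y
IsHittingSet-resp X≗Y X-hitting (a , b , c , a∉Y , b∉Y , c∉Y , p) =
  X-hitting (a , b , c , trans (X≗Y a) a∉Y , trans (X≗Y b) b∉Y , trans (X≗Y c) c∉Y , p)

adj⇒≢ : ∀ {n} (G : Graph n) {x y} → Adj G x y → x ≢ y
adj⇒≢ G {x} x~x refl with trans (sym (irrefl G x)) x~x
... | ()

record IsInducedEmbedding {m n} (H : Graph m) (G : Graph n) (f : Fin m → Fin n) : Set where
  field
    injective : Injective _≡_ _≡_ f
    adj-cong  : ∀ x y → adj G (f x) (f y) ≡ adj H x y

module _ {m n} {H : Graph m} {G : Graph n} {f : Fin m → Fin n} (emb : IsInducedEmbedding H G f) where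
  open IsInducedEmbedding emb

  P3-image : ∀ {a b c} → P3 H a b c → P3 G (f a) (f b) (f c)
  P3-image {a} {b} {c} (a≢c , a~b , b~c , a≁c) =
    a≢c ∘ injective , trans (adj-cong a b) a~b , trans (adj-cong b c) b~c , a≁c ∘ trans (sym (adj-cong a c))

  P3-preimage : ∀ {a b c} → P3 G (f a) (f b) (f c) → P3 H a b c
  P3-preimage {a} {b} {c} (a≢c , a~b , b~c , a≁c) =
    a≢c ∘ cong f , trans (sym (adj-cong a b)) a~b , trans (sym (adj-cong b c)) b~c , a≁c ∘ trans (adj-cong a c)

  IsHittingSet-preimage : ∀ {X} → IsHittingSet G X → IsHittingSet H (X ∘ f)
  IsHittingSet-preimage X-hitting (a , b , c , a∉X , b∉X , c∉X , p) =
    X-hitting (f a , f b , f c , a∉X , b∉X , c∉X , P3-image p)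

id-isInducedEmbedding : ∀ {n} {G : Graph n} → IsInducedEmbedding G G id
id-isInducedEmbedding = record { injective = id ; adj-cong = λ _ _ → refl }

∘-isInducedEmbedding : ∀ {k m n} {F : Graph k} {H : Graph m} {G : Graph n} {f g} →
                       IsInducedEmbedding H G g → IsInducedEmbedding F H f → IsInducedEmbedding F G (g ∘ f)
∘-isInducedEmbedding emb-g emb-f = record
  { injective = IsInducedEmbedding.injective emb-f ∘ IsInducedEmbedding.injective emb-g
  ; adj-cong  = λ x y → trans (IsInducedEmbedding.adj-cong emb-g _ _) (IsInducedEmbedding.adj-cong emb-f x y)
  }

module _ {n} (G : Graph (suc n)) (v : Fin (suc n)) where

  punchIn-isInducedEmbedding : IsInducedEmbedding (deleteVertex G v) G (punchIn v)
  punchIn-isInducedEmbedding = record { injective = punchIn-injective v _ _ ; adj-cong = λ _ _ → refl }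

  punchIn-onto : ∀ {x} → x ≢ v → ∃ λ x′ → punchIn v x′ ≡ x
  punchIn-onto x≢v = punchOut (x≢v ∘ sym) , punchIn-punchOut _

  P3Outside-deleteVertex : ∀ X {a b c} → Avoids v a b c → P3Outside G X a b c →
                           HasInducedP3Outside (deleteVertex G v) (X ∘ punchIn v)
  P3Outside-deleteVertex X (a≢v , b≢v , c≢v) (a∉X , b∉X , c∉X , p)
    with punchIn-onto a≢v | punchIn-onto b≢v | punchIn-onto c≢v
  ... | a′ , refl | b′ , refl | c′ , refl =
    a′ , b′ , c′ , a∉X , b∉X , c∉X , P3-preimage punchIn-isInducedEmbedding p

data Swapped {n} (s t : Fin n) : Fin n → Fin n → Set where
  s↦t   : Swapped s t s t
  t↦s   : Swapped s t t s
  fixed : ∀ {k} → k ≢ s → k ≢ t → Swapped s t k k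

transpose-swapped : ∀ {n} (s t k : Fin n) → Swapped s t k (transpose s t k)
transpose-swapped s t k with k ≟ s
... | yes refl = s↦t
... | no k≢s with k ≟ t
...   | yes refl = t↦s
...   | no k≢t   = fixed k≢s k≢t

transpose-matchˡ : ∀ {n} (s t : Fin n) → transpose s t s ≡ t
transpose-matchˡ s t with transpose s t s | transpose-swapped s t s
... | _ | s↦t         = refl
... | _ | t↦s         = refl
... | _ | fixed s≢s _ = ⊥-elim (s≢s refl)

transpose-fixed : ∀ {n} {s t k : Fin n} → k ≢ s → k ≢ t → transpose s t k ≡ k
transpose-fixed {s = s} {t} {k} k≢s k≢t with transpose s t k | transpose-swapped s t k
... | _ | s↦t     = ⊥-elim (k≢s refl)
... | _ | t↦s     = ⊥-elim (k≢t refl)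
... | _ | fixed _ _ = refl

transpose-avoids : ∀ {n} {s t k : Fin n} → k ≢ s → transpose s t k ≢ t
transpose-avoids {s = s} {t} {k} k≢s with transpose s t k | transpose-swapped s t k
... | _ | s↦t         = ⊥-elim (k≢s refl)
... | _ | t↦s         = k≢s ∘ sym
... | _ | fixed _ k≢t = k≢t

transpose-injective : ∀ {n} (s t : Fin n) → Injective _≡_ _≡_ (transpose s t)
transpose-injective s t {x} {y} σx≡σy = begin
  x                                  ≡⟨ sym (transpose-inverse t s) ⟩
  transpose t s (transpose s t x)    ≡⟨ cong (transpose t s) σx≡σy ⟩
  transpose t s (transpose s t y)    ≡⟨ transpose-inverse t s ⟩
  y                                  ∎
  where open ≡-Reasoning

module _ {n} (G : Graph n) {s t : Fin n} (twins : TrueTwins G s t) where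

  private
    s~t : Adj G s t
    s~t = proj₁ twins

    twin : ∀ x → x ≢ s → x ≢ t → adj G s x ≡ adj G t x
    twin = proj₂ twins

  P3-meets-both-twins : ∀ {a b c} → P3 G a b c → Meets s a b c → Meets t a b c → ⊥
  P3-meets-both-twins {a} {b} {c} (a≢c , a~b , b~c , a≁c) = go
    where
    go : Meets s a b c → Meets t a b c → ⊥
    go (inj₁ refl)        (inj₁ refl)        = adj⇒≢ G s~t refl
    go (inj₂ (inj₁ refl)) (inj₂ (inj₁ refl)) = adj⇒≢ G s~t refl
    go (inj₂ (inj₂ refl)) (inj₂ (inj₂ refl)) = adj⇒≢ G s~t refl
    go (inj₁ refl)        (inj₂ (inj₂ refl)) = a≁c s~t
    go (inj₂ (inj₂ refl)) (inj₁ refl)        = a≁c (trans (Graph.sym G _ _) s~t)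
    go (inj₁ refl)        (inj₂ (inj₁ refl)) =
      a≁c (trans (twin _ (a≢c ∘ sym) (adj⇒≢ G b~c ∘ sym)) b~c)
    go (inj₂ (inj₁ refl)) (inj₁ refl)        =
      a≁c (trans (sym (twin _ (adj⇒≢ G b~c ∘ sym) (a≢c ∘ sym))) b~c)
    go (inj₂ (inj₁ refl)) (inj₂ (inj₂ refl)) =
      a≁c (trans (Graph.sym G _ _) (trans (sym (twin _ (adj⇒≢ G a~b) a≢c)) (trans (Graph.sym G _ _) a~b)))
    go (inj₂ (inj₂ refl)) (inj₂ (inj₁ refl)) =
      a≁c (trans (Graph.sym G _ _) (trans (twin _ a≢c (adj⇒≢ G a~b)) (trans (Graph.sym G _ _) a~b)))

  P3-avoids-twin : ∀ {a b c} → P3 G a b c → Avoids s a b c ⊎ Avoids t a b c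
  P3-avoids-twin {a} {b} {c} p with meets-or-avoids s a b c | meets-or-avoids t a b c
  ... | inj₂ s∉  | _        = inj₁ s∉
  ... | inj₁ _   | inj₂ t∉  = inj₂ t∉
  ... | inj₁ s∈  | inj₁ t∈  = ⊥-elim (P3-meets-both-twins p s∈ t∈)

  transpose-isInducedEmbedding : IsInducedEmbedding G G (transpose s t)
  transpose-isInducedEmbedding = record { injective = transpose-injective s t ; adj-cong = adj-transpose }
    where
    adj-s≡adj-t : adj G s s ≡ adj G t t
    adj-s≡adj-t = trans (irrefl G s) (sym (irrefl G t))

    twinʳ : ∀ x → x ≢ s → x ≢ t → adj G x s ≡ adj G x t
    twinʳ x x≢s x≢t = trans (Graph.sym G x s) (trans (twin x x≢s x≢t) (Graph.sym G t x))

    adj-transpose : ∀ x y → adj G (transpose s t x) (transpose s t y) ≡ adj G x y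
    adj-transpose x y with transpose s t x | transpose-swapped s t x | transpose s t y | transpose-swapped s t y
    ... | _ | s↦t           | _ | s↦t           = sym adj-s≡adj-t
    ... | _ | s↦t           | _ | t↦s           = Graph.sym G t s
    ... | _ | s↦t           | _ | fixed y≢s y≢t = sym (twin y y≢s y≢t)
    ... | _ | t↦s           | _ | s↦t           = Graph.sym G s t
    ... | _ | t↦s           | _ | t↦s           = adj-s≡adj-t
    ... | _ | t↦s           | _ | fixed y≢s y≢t = twin y y≢s y≢t
    ... | _ | fixed x≢s x≢t | _ | s↦t           = sym (twinʳ x x≢s x≢t)
    ... | _ | fixed x≢s x≢t | _ | t↦s           = twinʳ x x≢s x≢t
    ... | _ | fixed _ _     | _ | fixed _ _     = refl

  transposeIf-isInducedEmbedding : ∀ b → IsInducedEmbedding G G (if b then transpose s t else id)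
  transposeIf-isInducedEmbedding true  = transpose-isInducedEmbedding
  transposeIf-isInducedEmbedding false = id-isInducedEmbedding

module _ {n} (u' : Fin (suc n)) (w : Fin n) where

  private
    u : Fin (suc n)
    u = punchIn u' w

  contract : Fin (suc n) → Fin n
  contract v with v ≟ u'
  ... | yes _    = w
  ... | no v≢u' = punchOut (v≢u' ∘ sym)

  contract-punchIn : ∀ i → contract (punchIn u' i) ≡ i
  contract-punchIn i with punchIn u' i ≟ u'
  ... | yes eq = ⊥-elim (punchInᵢ≢i u' i eq)
  ... | no _   = trans (punchOut-cong u' refl) (punchOut-punchIn u')

  contract-self : contract u' ≡ w
  contract-self with u' ≟ u'
  ... | yes _    = refl
  ... | no u'≢u' = ⊥-elim (u'≢u' refl)

  contract-transpose : ∀ v → contract (transpose u u' v) ≡ contract v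
  contract-transpose v with transpose u u' v | transpose-swapped u u' v
  ... | _ | s↦t       = trans contract-self (sym (contract-punchIn w))
  ... | _ | t↦s       = trans (contract-punchIn w) (sym contract-self)
  ... | _ | fixed _ _ = refl

  restrictMerged : VSet (suc n) → VSet n
  restrictMerged X = X ∘ (if X u then transpose u u' else id) ∘ punchIn u'

  restrictMerged-merged : ∀ X → restrictMerged X w ≡ X u ∧ X u'
  restrictMerged-merged X with X u in u∈?X
  ... | true  = cong X (transpose-matchˡ u u')
  ... | false = u∈?X

  restrictMerged-other : ∀ X {i} → i ≢ w → restrictMerged X i ≡ X (punchIn u' i)
  restrictMerged-other X {i} i≢w with X u
  ... | true  = cong X (transpose-fixed (i≢w ∘ punchIn-injective u' i w) (punchInᵢ≢i u' i))
  ... | false = refl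

  module _ {a ℓ} (W : Weights a ℓ) (c : Fin (suc n) → Weights.Carrier W) where
    open Weights W

    contract-cost : ∀ Y → cost W c (Y ∘ contract) ≡ cost W (mergedCost W c u' w) Y
    contract-cost Y =
      trans (sumFin-mergedCost W (λ v → if Y (contract v) then c v else 0#) u' w) (sumFin-cong W pointwise)
      where
      pointwise : ∀ i → mergedCost W (λ v → if Y (contract v) then c v else 0#) u' w i
                      ≡ (if Y i then mergedCost W c u' w i else 0#)
      pointwise i with i ≟ w
      ... | yes refl rewrite contract-punchIn w | contract-self = sym (if-+-distrib W (Y w) _ _)
      ... | no _     rewrite contract-punchIn i = refl

    restrictMerged-cost : ∀ X → cost W (mergedCost W c u' w) (restrictMerged X) ≤ cost W c X
    restrictMerged-cost X =
      ≤-trans (sumFin-mono-≤ W pointwise) (≤-reflexive W (sym (sumFin-mergedCost W _ u' w)))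
      where
      pointwise : ∀ i → (if restrictMerged X i then mergedCost W c u' w i else 0#)
                      ≤ mergedCost W (λ v → if X v then c v else 0#) u' w i
      pointwise i with i ≟ w
      ... | yes refl rewrite restrictMerged-merged X = if-∧-≤ W (X u) (X u') _ _
      ... | no i≢w   rewrite restrictMerged-other X i≢w = ≤-refl

  module _ (G : Graph (suc n)) (twins : TrueTwins G u u') where

    IsHittingSet-transpose-invariant : ∀ {X} → (∀ v → X (transpose u u' v) ≡ X v) →
                                       IsHittingSet (deleteVertex G u') (X ∘ punchIn u') → IsHittingSet G X
    IsHittingSet-transpose-invariant {X} X-invariant hitting′ (a , b , c , outside@(a∉X , b∉X , c∉X , p))
      with P3-avoids-twin G twins p
    ... | inj₂ avoids-u' = hitting′ (P3Outside-deleteVertex G u' X avoids-u' outside)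
    ... | inj₁ (a≢u , b≢u , c≢u) =
      hitting′ (P3Outside-deleteVertex G u' X
        (transpose-avoids a≢u , transpose-avoids b≢u , transpose-avoids c≢u)
        (trans (X-invariant a) a∉X , trans (X-invariant b) b∉X , trans (X-invariant c) c∉X ,
         P3-image (transpose-isInducedEmbedding G twins) p))

    contract-hitting : ∀ {Y} → IsHittingSet (deleteVertex G u') Y → IsHittingSet G (Y ∘ contract)
    contract-hitting {Y} hitting′ =
      IsHittingSet-transpose-invariant (cong Y ∘ contract-transpose)
        (IsHittingSet-resp {G = deleteVertex G u'} (λ i → cong Y (sym (contract-punchIn i))) hitting′)

    restrictMerged-hitting : ∀ {X} → IsHittingSet G X → IsHittingSet (deleteVertex G u') (restrictMerged X)
    restrictMerged-hitting {X} =
      IsHittingSet-preimage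
        (∘-isInducedEmbedding (transposeIf-isInducedEmbedding G twins (X u))
                              (punchIn-isInducedEmbedding G u'))

lemma2 : ∀ {a ℓ} (W : Weights a ℓ) (n : ℕ) (G : Graph (suc n))
         (c : Fin (suc n) → Weights.Carrier W)
         (u' : Fin (suc n)) (w : Fin n) →
         TrueTwins G (punchIn u' w) u' →
         ∀ m → IsOPT W G c m ⇔ IsOPT W (deleteVertex G u') (mergedCost W c u' w) m
lemma2 W n G c u' w twins = IsOPT-⇔ W merge split
  where
  merge : HittingSetReduction W G c (deleteVertex G u') (mergedCost W c u' w)
  merge = record
    { reduce         = restrictMerged u' w
    ; reduce-hitting = restrictMerged-hitting u' w G twins
    ; reduce-cost    = restrictMerged-cost u' w W c
    }
  split : HittingSetReduction W (deleteVertex G u') (mergedCost W c u' w) G c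
  split = record
    { reduce         = _∘ contract u' w
    ; reduce-hitting = contract-hitting u' w G twins
    ; reduce-cost    = ≤-reflexive W ∘ contract-cost u' w W c
    }
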